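{- Let $w$ be a recurrent infinite word. If the set of palindromic factors of $w$ is a proper subset of the set of privileged factors of $w$, then $w$ has infinite palindromic defect.
   Context: An infinite word is recurrent if each of its factors occurs in it infinitely often. A palindrome is a word equal to its reversal (the empty word is a palindrome). The (palindromic) defect of a finite word $u$ is $|u|+1$ minus the number of distinct palindromic factors of $u$; the defect of an infinite word is the supremum of the defects of its prefixes. A complete first return to a word $v$ is a word that begins with $v$, ends with $v$, and contains exactly two occurrences of $v$. Privileged words: the empty word and every letter are privileged, and a word is privileged if it is a complete first return to a shorter privileged word. -}

module Defs where

open import Data.Nat using (ℕ; zero; suc; _+_; _∸_; _≤_; _<_)
open import Data.List using (List; []; _∷_; length; take; drop; reverse; filter; deduplicate; concatMap; upTo; _++_)
open import Data.List.Properties using (≡-dec)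
open import Data.Product using (Σ; ∃; _×_; _,_)
open import Data.Sum using (_⊎_)
open import Relation.Binary.PropositionalEquality using (_≡_; _≢_)
open import Relation.Binary.Definitions using (DecidableEquality)
open import Relation.Nullary using (¬_)

Word∞ : Set → Set
Word∞ A = ℕ → A

window : {A : Set} → Word∞ A → ℕ → ℕ → List A
window w i zero    = []
window w i (suc n) = w i ∷ window w (suc i) n

prefix : {A : Set} → Word∞ A → ℕ → List A
prefix w n = window w 0 n

Factor∞ : {A : Set} → List A → Word∞ A → Set
Factor∞ u w = ∃ λ i → window w i (length u) ≡ u

Recurrent : {A : Set} → Word∞ A → Set
Recurrent w = ∀ u → Factor∞ u w → ∀ m → ∃ λ j → m ≤ j × window w j (length u) ≡ u

IsPalindrome : {A : Set} → List A → Set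
IsPalindrome u = reverse u ≡ u

OccursAt : {A : Set} → List A → List A → ℕ → Set
OccursAt v u i = (i + length v ≤ length u) × (take (length v) (drop i u) ≡ v)

IsPrefix : {A : Set} → List A → List A → Set
IsPrefix v u = ∃ λ s → v ++ s ≡ u

IsSuffix : {A : Set} → List A → List A → Set
IsSuffix v u = ∃ λ p → p ++ v ≡ u

CompleteFirstReturn : {A : Set} → List A → List A → Set
CompleteFirstReturn v u =
  IsPrefix v u × IsSuffix v u ×
  (∃ λ i → ∃ λ j → i < j × OccursAt v u i × OccursAt v u j ×
     (∀ k → OccursAt v u k → k ≡ i ⊎ k ≡ j))

data Privileged {A : Set} : List A → Set where
  priv-empty  : Privileged []
  priv-letter : (a : A) → Privileged (a ∷ [])
  priv-return : {v u : List A} → Privileged v → length v < length u →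
                CompleteFirstReturn v u → Privileged u

module _ {A : Set} (_≟_ : DecidableEquality A) where

  -- list of all factors (with repetition, including the empty word) of a finite word
  allFactors : List A → List (List A)
  allFactors u = concatMap (λ i → concatMap (λ n → take n (drop i u) ∷ []) (upTo (suc (length u ∸ i)))) (upTo (suc (length u)))

  isPal? : (u : List A) → Relation.Nullary.Dec (reverse u ≡ u)
  isPal? u = ≡-dec _≟_ (reverse u) u

  numPalFactors : List A → ℕ
  numPalFactors u = length (deduplicate (≡-dec _≟_) (filter isPal? (allFactors u)))

  defect : List A → ℕ
  defect u = suc (length u) ∸ numPalFactors u

  -- infinite defect: the defects of prefixes are unbounded (supremum = ∞)
  InfiniteDefect : Word∞ A → Set
  InfiniteDefect w = ∀ k → ∃ λ n → k ≤ defect (prefix w n)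

module Submission where

open import Defs
open import Data.List using (List)
open import Data.Product using (∃; _×_)
open import Relation.Binary.Definitions using (DecidableEquality)
open import Relation.Nullary using (¬_)

open import Data.Nat
  using (ℕ; zero; suc; _+_; _∸_; _≤_; _<_; _≤′_; ≤′-refl; ≤′-step; z≤n; s≤s; _≤?_; _<?_)
open import Data.Nat.Properties
open import Data.List
  using ([]; _∷_; _++_; [_]; length; reverse; take; drop; filter; deduplicate; concatMap; upTo)
open import Data.List.Properties
  using ( ≡-dec; length-++; length-++-sucʳ; ++-assoc; ++-identityʳ; ++-identityʳ-unique; ++-conicalʳ
        ; ∷-injective; ∷-injectiveʳ; reverse-++; length-reverse; take++drop≡id)
open import Data.List.Membership.Propositional using (_∈_; lose)
open import Data.List.Membership.Propositional.Properties
  using ( ∈-∃++; ∈-++⁻; ∈-++⁺ˡ; ∈-++⁺ʳ; ∈-concatMap⁻; ∈-concatMap⁺; ∈-filter⁻; ∈-filter⁺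
        ; ∈-deduplicate⁻; ∈-deduplicate⁺; ∈-upTo⁺)
open import Data.List.Relation.Binary.Subset.Propositional using (_⊆_)
open import Data.List.Relation.Unary.Any using (here; there; satisfied)
open import Data.List.Relation.Unary.All using () renaming (lookup to All-lookup)
open import Data.List.Relation.Unary.AllPairs using (_∷_)
open import Data.List.Relation.Unary.Unique.Propositional using (Unique)
open import Data.List.Relation.Unary.Unique.DecPropositional.Properties using (deduplicate-!)
open import Data.Product using (∃₂; _,_; proj₁; proj₂)
open import Data.Sum using (_⊎_; inj₁; inj₂)
open import Data.Empty using (⊥-elim)
open import Function using (_∘_)
open import Relation.Binary.PropositionalEquality
  using (_≡_; _≢_; refl; sym; trans; cong; subst; module ≡-Reasoning)
open import Relation.Nullary using (yes; no)

-- Following the chain of complete first returns that makes a non-palindromic factor privileged,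
-- one finds a non-palindromic factor r that is a complete first return to a palindrome q.
-- A palindromic proper suffix of r is also a proper prefix of r: if it is shorter than q it is a
-- prefix of q, and if it is longer it begins with q, giving a third occurrence of q in r.
-- Hence no privileged palindrome ends with r (induct along its own chain of returns), and as all
-- palindromic factors of w are privileged, every palindromic suffix of a prefix of w that ends
-- with r occurs earlier in that prefix.  Appending a letter creates at most one new palindrome,
-- the longest palindromic suffix, and by recurrence infinitely many letters create none; so
-- |p| + 1 minus the number of palindromic factors of the prefix p grows without bound.

unique-⊆⇒length≤ : {X : Set} {xs ys : List X} → Unique xs → xs ⊆ ys → length xs ≤ length ys
unique-⊆⇒length≤ {xs = []}     _              _  = z≤n
unique-⊆⇒length≤ {xs = x ∷ xs} (x∉xs ∷ xs-!) xs⊆ys with ∈-∃++ (xs⊆ys (here refl))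
... | ys₁ , ys₂ , refl =
  ≤-trans (s≤s (unique-⊆⇒length≤ xs-! xs⊆ys₁ys₂)) (≤-reflexive (sym (length-++-sucʳ ys₁ x ys₂)))
  where
    xs⊆ys₁ys₂ : xs ⊆ ys₁ ++ ys₂
    xs⊆ys₁ys₂ z∈xs with ∈-++⁻ ys₁ (xs⊆ys (there z∈xs))
    ... | inj₁ z∈ys₁         = ∈-++⁺ˡ z∈ys₁
    ... | inj₂ (here refl)   = ⊥-elim (All-lookup x∉xs z∈xs refl)
    ... | inj₂ (there z∈ys₂) = ∈-++⁺ʳ ys₁ z∈ys₂

module _ {A : Set} where

  IsInfix : List A → List A → Set
  IsInfix f u = ∃₂ λ p s → p ++ f ++ s ≡ u

  OccursOnlyAtEnds : List A → List A → Set
  OccursOnlyAtEnds v u = ∀ p s → p ++ v ++ s ≡ u → p ≡ [] ⊎ s ≡ []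

  length-++-≡ : (a : List A) {b c : List A} → a ++ b ≡ c → length a + length b ≡ length c
  length-++-≡ a refl = sym (length-++ a)

  ++-split : (a : List A) {b c d : List A} → a ++ b ≡ c ++ d → length a ≤ length c →
             ∃ λ m → a ++ m ≡ c × m ++ d ≡ b
  ++-split []      {c = c} eq _ = c , refl , sym eq
  ++-split (x ∷ a) {c = y ∷ c} eq (s≤s a≤c) with ∷-injective eq
  ... | refl , eq′ with ++-split a eq′ a≤c
  ... | m , am≡c , md≡b = m , cong (x ∷_) am≡c , md≡b

  ++-cancel-≡-length : (a : List A) {b c d : List A} → a ++ b ≡ c ++ d → length a ≡ length c →
                       a ≡ c × b ≡ d
  ++-cancel-≡-length []      {c = []}    eq _ = refl , eq
  ++-cancel-≡-length (x ∷ a) {c = y ∷ c} eq |a|≡|c| with ∷-injective eq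
  ... | refl , eq′ with ++-cancel-≡-length a eq′ (suc-injective |a|≡|c|)
  ... | a≡c , b≡d = cong (x ∷_) a≡c , b≡d

  suffix-of-longer-suffix : (p : List A) {s p′ r : List A} → p ++ s ≡ p′ ++ r → length r ≤ length s →
                            IsSuffix r s
  suffix-of-longer-suffix p {p′ = p′} {r} eq r≤s = let m , _ , mr≡s = ++-split p eq p≤p′ in m , mr≡s
    where
      p≤p′ : length p ≤ length p′
      p≤p′ = +-cancelʳ-≤ (length r) (length p) (length p′)
               (≤-trans (+-monoʳ-≤ (length p) r≤s)
                        (≤-reflexive (trans (length-++-≡ p eq) (length-++ p′))))

  suffixes-of-equal-length : (p : List A) {s p′ s′ : List A} → p ++ s ≡ p′ ++ s′ →
                             length s ≡ length s′ → s ≡ s′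
  suffixes-of-equal-length p {s} {p′} {s′} eq |s|≡|s′| = proj₂ (++-cancel-≡-length p eq |p|≡|p′|)
    where
      |p|≡|p′| : length p ≡ length p′
      |p|≡|p′| = +-cancelʳ-≡ (length s) (length p) (length p′)
                   (trans (length-++-≡ p eq)
                          (trans (length-++ p′) (cong (length p′ +_) (sym |s|≡|s′|))))

  palindromic-suffix⇒prefix : {q s y : List A} → IsPalindrome q → IsPalindrome s →
                              y ++ s ≡ q → s ++ reverse y ≡ q
  palindromic-suffix⇒prefix {s = s} {y} q-pal s-pal refl = begin
    s ++ reverse y          ≡⟨ cong (_++ reverse y) s-pal ⟨
    reverse s ++ reverse y  ≡⟨ reverse-++ y s ⟨
    reverse (y ++ s)        ≡⟨ q-pal ⟩
    y ++ s                  ∎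
    where open ≡-Reasoning

  border-of-palindrome : {s p a b : List A} → IsPalindrome s → p ++ a ≡ s → b ++ p ≡ s →
                         IsPalindrome p
  border-of-palindrome {s} {p} {a} {b} s-pal pa≡s bp≡s =
    suffixes-of-equal-length (reverse a) rev (length-reverse p)
    where
      open ≡-Reasoning
      rev : reverse a ++ reverse p ≡ b ++ p
      rev = begin
        reverse a ++ reverse p  ≡⟨ reverse-++ p a ⟨
        reverse (p ++ a)        ≡⟨ cong reverse pa≡s ⟩
        reverse s               ≡⟨ s-pal ⟩
        s                       ≡⟨ bp≡s ⟨
        b ++ p                  ∎

  length≤1⇒palindrome : (u : List A) → length u ≤ 1 → IsPalindrome u
  length≤1⇒palindrome []          _ = refl
  length≤1⇒palindrome (_ ∷ [])    _ = refl
  length≤1⇒palindrome (_ ∷ _ ∷ _) (s≤s ())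

  drop-length-++ : (p x : List A) → drop (length p) (p ++ x) ≡ x
  drop-length-++ []      x = refl
  drop-length-++ (_ ∷ p) x = drop-length-++ p x

  take-length-++ : (v x : List A) → take (length v) (v ++ x) ≡ v
  take-length-++ []      x = refl
  take-length-++ (a ∷ v) x = cong (a ∷_) (take-length-++ v x)

  occursAt-length : (p : List A) {v s u : List A} → p ++ v ++ s ≡ u → OccursAt v u (length p)
  occursAt-length p {v} {s} refl =
    fits , trans (cong (take (length v)) (drop-length-++ p (v ++ s))) (take-length-++ v s)
    where
      fits : length p + length v ≤ length (p ++ v ++ s)
      fits = ≤-trans (+-monoʳ-≤ (length p) (m≤m+n (length v) (length s)))
                     (≤-reflexive (sym (trans (length-++ p) (cong (length p +_) (length-++ v)))))

  ++-rest≢[] : {a b c : List A} → a ++ b ≡ c → length a < length c → b ≢ []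
  ++-rest≢[] {a} ab≡c a<c refl = <-irrefl (cong length (trans (sym (++-identityʳ a)) ab≡c)) a<c

  length≡0⇒[] : (u : List A) → length u ≡ 0 → u ≡ []
  length≡0⇒[] [] _ = refl

  completeFirstReturn⇒occursOnlyAtEnds : {v u : List A} → length v < length u →
                                          CompleteFirstReturn v u → OccursOnlyAtEnds v u
  completeFirstReturn⇒occursOnlyAtEnds {v} {u} v<u
    ((a , va≡u) , (t , tv≡u) , i , j , i<j , _ , _ , only-i-j) p s pvs≡u
    with only-i-j 0 (occursAt-length [] va≡u) | only-i-j (length t) (occursAt-length t tv++[]≡u)
       | only-i-j (length p) (occursAt-length p pvs≡u)
    where
      tv++[]≡u : t ++ v ++ [] ≡ u
      tv++[]≡u = trans (cong (t ++_) (++-identityʳ v)) tv≡u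
  ... | inj₂ refl | _          | _            = ⊥-elim (n≮0 i<j)
  ... | inj₁ refl | inj₁ |t|≡0 | _            = ⊥-elim (<-irrefl |v|≡|u| v<u)
    where
      |v|≡|u| : length v ≡ length u
      |v|≡|u| = trans (cong (_+ length v) (sym |t|≡0)) (length-++-≡ t tv≡u)
  ... | inj₁ refl | inj₂ refl  | inj₁ |p|≡0   = inj₁ (length≡0⇒[] p |p|≡0)
  ... | inj₁ refl | inj₂ refl  | inj₂ |p|≡|t| =
    inj₂ (++-identityʳ-unique v (sym (proj₂ (++-cancel-≡-length p (trans pvs≡u (sym tv≡u)) |p|≡|t|))))

  infix-of-init : (p : List A) {s m x : List A} {a : A} → p ++ s ++ m ≡ x ++ [ a ] → m ≢ [] →
                  IsInfix s x
  infix-of-init p {m = []}    _  m≢[] = ⊥-elim (m≢[] refl)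
  infix-of-init p {s} {c ∷ m} {x} eq _ with ++-split (p ++ s) (trans (++-assoc p s (c ∷ m)) eq) |ps|≤|x|
    where
      |ps|≤|x| : length (p ++ s) ≤ length x
      |ps|≤|x| = +-cancelʳ-≤ 1 (length (p ++ s)) (length x)
        (≤-trans (+-monoʳ-≤ (length (p ++ s)) (s≤s z≤n))
                 (≤-reflexive (trans (length-++-≡ (p ++ s) (trans (++-assoc p s (c ∷ m)) eq))
                                     (length-++ x))))
  ... | m′ , psm′≡x , _ = p , m′ , trans (sym (++-assoc p s m′)) psm′≡x

  infix-snoc : {f x : List A} {a : A} → IsInfix f (x ++ [ a ]) → IsInfix f x ⊎ IsSuffix f (x ++ [ a ])
  infix-snoc {f} (p , []    , e) = inj₂ (p , trans (cong (p ++_) (sym (++-identityʳ f))) e)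
  infix-snoc     (p , c ∷ s , e) = inj₁ (infix-of-init p e λ ())

  record LongestPalindromicSuffix (y : List A) : Set where
    field
      word       : List A
      suffix     : IsSuffix word y
      palindrome : IsPalindrome word
      longest    : {s : List A} → IsSuffix s y → IsPalindrome s → length s ≤ length word

  module _ {x : List A} {a : A} (L : LongestPalindromicSuffix (x ++ [ a ])) where
    open LongestPalindromicSuffix L

    newPalindrome≡longestPalindromicSuffix : {f : List A} → IsInfix f (x ++ [ a ]) → IsPalindrome f →
                                              IsInfix f x ⊎ f ≡ word
    newPalindrome≡longestPalindromicSuffix {f} f-infix f-pal with infix-snoc f-infix
    ... | inj₁ f-infix-x = inj₁ f-infix-x
    ... | inj₂ (t , tf≡xa) with suffix | length f <? length word
    ...   | t₀ , t₀w≡xa | no f≮w =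
      inj₂ (suffixes-of-equal-length t (trans tf≡xa (sym t₀w≡xa))
                                     (≤-antisym (longest (t , tf≡xa) f-pal) (≮⇒≥ f≮w)))
    ...   | t₀ , t₀w≡xa | yes f<w with suffix-of-longer-suffix t₀ (trans t₀w≡xa (sym tf≡xa)) (<⇒≤ f<w)
    ...     | m , mf≡w =
      inj₁ (infix-of-init t₀ (trans (cong (t₀ ++_) fm′≡w) t₀w≡xa) (++-rest≢[] fm′≡w f<w))
      where
        fm′≡w : f ++ reverse m ≡ word
        fm′≡w = palindromic-suffix⇒prefix palindrome f-pal mf≡w

  record ReturnToPalindrome (q r : List A) : Set where
    field
      palindrome    : IsPalindrome q
      nonPalindrome : ¬ IsPalindrome r
      shorter       : length q < length r
      firstReturn   : CompleteFirstReturn q r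

  module Return {q r : List A} (ret : ReturnToPalindrome q r) where
    open ReturnToPalindrome ret

    private
      t₁ : List A
      t₁ = proj₁ (proj₁ firstReturn)
      qt₁≡r : q ++ t₁ ≡ r
      qt₁≡r = proj₂ (proj₁ firstReturn)
      t₂ : List A
      t₂ = proj₁ (proj₁ (proj₂ firstReturn))
      t₂q≡r : t₂ ++ q ≡ r
      t₂q≡r = proj₂ (proj₁ (proj₂ firstReturn))
      q-atEnds : OccursOnlyAtEnds q r
      q-atEnds = completeFirstReturn⇒occursOnlyAtEnds shorter firstReturn
      t₁≢[] : t₁ ≢ []
      t₁≢[] = ++-rest≢[] qt₁≡r shorter

    palindromicProperSuffix⇒properPrefix : {s y : List A} → IsPalindrome s → y ++ s ≡ r →
                                            length s < length r → ∃ λ v → s ++ v ≡ r × v ≢ []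
    palindromicProperSuffix⇒properPrefix {s} {y} s-pal ys≡r s<r with length s ≤? length q
    ... | yes s≤q with suffix-of-longer-suffix t₂ (trans t₂q≡r (sym ys≡r)) s≤q
    ...   | y′ , y′s≡q = reverse y′ ++ t₁ , s·v≡r , t₁≢[] ∘ ++-conicalʳ (reverse y′) t₁
      where
        open ≡-Reasoning
        s·v≡r : s ++ reverse y′ ++ t₁ ≡ r
        s·v≡r = begin
          s ++ reverse y′ ++ t₁    ≡⟨ ++-assoc s (reverse y′) t₁ ⟨
          (s ++ reverse y′) ++ t₁  ≡⟨ cong (_++ t₁) (palindromic-suffix⇒prefix palindrome s-pal y′s≡q) ⟩
          q ++ t₁                  ≡⟨ qt₁≡r ⟩
          r                        ∎
    palindromicProperSuffix⇒properPrefix {s} {y} s-pal ys≡r s<r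
      | no s≰q with suffix-of-longer-suffix y (trans ys≡r (sym t₂q≡r)) (<⇒≤ (≰⇒> s≰q))
    ...   | y″ , y″q≡s with palindromic-suffix⇒prefix s-pal palindrome y″q≡s
    ...     | qy″≡s with q-atEnds y (reverse y″) (trans (cong (y ++_) qy″≡s) ys≡r)
    ...       | inj₁ refl  = ⊥-elim (<-irrefl (cong length ys≡r) s<r)
    ...       | inj₂ y″≡[] = ⊥-elim (++-rest≢[] qy″≡s (≰⇒> s≰q) y″≡[])

    private
      short-¬endsWith : {s : List A} → length s ≤ 1 → ¬ IsSuffix r s
      short-¬endsWith s≤1 (p , pr≡s) =
        nonPalindrome (length≤1⇒palindrome r
          (m+n≤o⇒n≤o (length p) (≤-trans (≤-reflexive (length-++-≡ p pr≡s)) s≤1)))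

    privilegedPalindrome-¬endsWith : {s : List A} → Privileged s → IsPalindrome s → ¬ IsSuffix r s
    privilegedPalindrome-¬endsWith priv-empty      _ = short-¬endsWith z≤n
    privilegedPalindrome-¬endsWith (priv-letter a) _ = short-¬endsWith ≤-refl
    privilegedPalindrome-¬endsWith
      (priv-return {p₁} p₁-priv p₁<s cfr@((_ , p₁a≡s) , (b , bp₁≡s) , _)) s-pal (m , mr≡s)
      with border-of-palindrome s-pal p₁a≡s bp₁≡s | length r ≤? length p₁
    ... | p₁-pal | yes r≤p₁ =
      privilegedPalindrome-¬endsWith p₁-priv p₁-pal (suffix-of-longer-suffix b (trans bp₁≡s (sym mr≡s)) r≤p₁)
    ... | p₁-pal | no r≰p₁ with suffix-of-longer-suffix m (trans mr≡s (sym bp₁≡s)) (<⇒≤ (≰⇒> r≰p₁))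
    ...   | y , yp₁≡r with palindromicProperSuffix⇒properPrefix p₁-pal yp₁≡r (≰⇒> r≰p₁)
    ...     | v , p₁v≡r , v≢[]
            with completeFirstReturn⇒occursOnlyAtEnds p₁<s cfr m v (trans (cong (m ++_) p₁v≡r) mr≡s)
    ...       | inj₁ refl = nonPalindrome (subst IsPalindrome (sym mr≡s) s-pal)
    ...       | inj₂ v≡[] = v≢[] v≡[]

    noNewPalindrome : {x : List A} {a : A} → (∀ f → IsInfix f (x ++ [ a ]) → IsPalindrome f → Privileged f) →
                      IsSuffix r (x ++ [ a ]) → ∀ f → IsInfix f (x ++ [ a ]) → IsPalindrome f → IsInfix f x
    noNewPalindrome palPriv (z , zr≡xa) f f-infix f-pal with infix-snoc f-infix
    ... | inj₁ f-infix-x = f-infix-x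
    ... | inj₂ (t , tf≡xa) with length r ≤? length f
    ...   | yes r≤f = ⊥-elim (privilegedPalindrome-¬endsWith (palPriv f f-infix f-pal) f-pal
                                (suffix-of-longer-suffix t (trans tf≡xa (sym zr≡xa)) r≤f))
    ...   | no r≰f with suffix-of-longer-suffix z (trans zr≡xa (sym tf≡xa)) (<⇒≤ (≰⇒> r≰f))
    ...     | y , yf≡r with palindromicProperSuffix⇒properPrefix f-pal yf≡r (≰⇒> r≰f)
    ...       | v , fv≡r , v≢[] = infix-of-init z (trans (cong (z ++_) fv≡r) zr≡xa) v≢[]

module _ {A : Set} (_≟_ : DecidableEquality A) where

  privilegedNonPalindrome⇒return : {u : List A} → Privileged u → ¬ IsPalindrome u →
                                    ∃₂ λ q r → IsPrefix r u × ReturnToPalindrome q r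
  privilegedNonPalindrome⇒return priv-empty      ¬pal = ⊥-elim (¬pal refl)
  privilegedNonPalindrome⇒return (priv-letter a) ¬pal = ⊥-elim (¬pal refl)
  privilegedNonPalindrome⇒return {u} (priv-return {v} v-priv v<u cfr@((t′ , vt′≡u) , _)) ¬pal
    with isPal? _≟_ v
  ... | yes v-pal = v , u , ([] , ++-identityʳ u) , record
          { palindrome = v-pal ; nonPalindrome = ¬pal ; shorter = v<u ; firstReturn = cfr }
  ... | no ¬v-pal with privilegedNonPalindrome⇒return v-priv ¬v-pal
  ...   | q , r , (t , rt≡v) , ret =
    q , r , (t ++ t′ , trans (sym (++-assoc r t t′)) (trans (cong (_++ t′) rt≡v) vt′≡u)) , ret

  private
    factorsAt : List A → ℕ → List (List A)
    factorsAt u i = concatMap (λ n → take n (drop i u) ∷ []) (upTo (suc (length u ∸ i)))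

  ∈-allFactors⁻ : {f u : List A} → f ∈ allFactors _≟_ u → IsInfix f u
  ∈-allFactors⁻ {u = u} f∈ with satisfied (∈-concatMap⁻ (factorsAt u) {xs = upTo (suc (length u))} f∈)
  ... | i , f∈ᵢ
    with satisfied (∈-concatMap⁻ (λ n → take n (drop i u) ∷ []) {xs = upTo (suc (length u ∸ i))} f∈ᵢ)
  ...   | n , here refl = take i u , drop n (drop i u) ,
            trans (cong (take i u ++_) (take++drop≡id n (drop i u))) (take++drop≡id i u)

  ∈-allFactors⁺ : {f u : List A} → IsInfix f u → f ∈ allFactors _≟_ u
  ∈-allFactors⁺ {f} {u} (p , s , pfs≡u) =
    ∈-concatMap⁺ (factorsAt u) {xs = upTo (suc (length u))} (lose (∈-upTo⁺ (s≤s |p|≤|u|))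
      (∈-concatMap⁺ (λ n → take n (drop (length p) u) ∷ []) {xs = upTo (suc (length u ∸ length p))}
        (lose (∈-upTo⁺ (s≤s |f|≤|u|∸|p|)) (here (sym (proj₂ f-at-p))))))
    where
      f-at-p : OccursAt f u (length p)
      f-at-p = occursAt-length p pfs≡u
      |p|+|f|≤|u| : length p + length f ≤ length u
      |p|+|f|≤|u| = proj₁ f-at-p
      |p|≤|u| : length p ≤ length u
      |p|≤|u| = m+n≤o⇒m≤o (length p) |p|+|f|≤|u|
      |f|≤|u|∸|p| : length f ≤ length u ∸ length p
      |f|≤|u|∸|p| =
        m+n≤o⇒m≤o∸n (length f) (≤-trans (≤-reflexive (+-comm (length f) (length p))) |p|+|f|≤|u|)

  palindromicFactors : List A → List (List A)
  palindromicFactors u = deduplicate (≡-dec _≟_) (filter (isPal? _≟_) (allFactors _≟_ u))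

  palindromicFactors-unique : (u : List A) → Unique (palindromicFactors u)
  palindromicFactors-unique u = deduplicate-! (≡-dec _≟_) (filter (isPal? _≟_) (allFactors _≟_ u))

  ∈-palindromicFactors⁻ : {f u : List A} → f ∈ palindromicFactors u → IsInfix f u × IsPalindrome f
  ∈-palindromicFactors⁻ {u = u} f∈
    with ∈-filter⁻ (isPal? _≟_) (∈-deduplicate⁻ (≡-dec _≟_) (filter (isPal? _≟_) (allFactors _≟_ u)) f∈)
  ... | f∈factors , f-pal = ∈-allFactors⁻ f∈factors , f-pal

  ∈-palindromicFactors⁺ : {f u : List A} → IsInfix f u → IsPalindrome f → f ∈ palindromicFactors u
  ∈-palindromicFactors⁺ f-infix f-pal =
    ∈-deduplicate⁺ (≡-dec _≟_) (∈-filter⁺ (isPal? _≟_) (∈-allFactors⁺ f-infix) f-pal)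

  numPalFactors-mono : {u u′ : List A} → (∀ f → IsInfix f u′ → IsPalindrome f → IsInfix f u) →
                       numPalFactors _≟_ u′ ≤ numPalFactors _≟_ u
  numPalFactors-mono {u′ = u′} pals⊆ =
    unique-⊆⇒length≤ (palindromicFactors-unique u′) λ f∈ →
      let f-infix , f-pal = ∈-palindromicFactors⁻ f∈ in ∈-palindromicFactors⁺ (pals⊆ _ f-infix f-pal) f-pal

  longestPalindromicSuffix : (y : List A) → LongestPalindromicSuffix y
  longestPalindromicSuffix [] = record
    { word = [] ; suffix = [] , refl ; palindrome = refl
    ; longest = λ (t , ts≡[]) _ → ≤-reflexive (m+n≡0⇒n≡0 (length t) (length-++-≡ t ts≡[])) }
  longestPalindromicSuffix (c ∷ y) with isPal? _≟_ (c ∷ y)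
  ... | yes pal = record
    { word = c ∷ y ; suffix = [] , refl ; palindrome = pal
    ; longest = λ (t , ts≡y) _ → m+n≤o⇒n≤o (length t) (≤-reflexive (length-++-≡ t ts≡y)) }
  ... | no ¬pal = record
    { word = word ; suffix = c ∷ proj₁ suffix , cong (c ∷_) (proj₂ suffix)
    ; palindrome = palindrome ; longest = longest′ }
    where
      open LongestPalindromicSuffix (longestPalindromicSuffix y)
      longest′ : {s : List A} → IsSuffix s (c ∷ y) → IsPalindrome s → length s ≤ length word
      longest′ ([]    , refl) s-pal = ⊥-elim (¬pal s-pal)
      longest′ (_ ∷ t , ts≡y) s-pal = longest (t , ∷-injectiveʳ ts≡y) s-pal

  numPalFactors-snoc : (x : List A) (a : A) → numPalFactors _≟_ (x ++ [ a ]) ≤ suc (numPalFactors _≟_ x)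
  numPalFactors-snoc x a =
    unique-⊆⇒length≤ (palindromicFactors-unique (x ++ [ a ])) ⊆lps∷pals
    where
      lps : LongestPalindromicSuffix (x ++ [ a ])
      lps = longestPalindromicSuffix (x ++ [ a ])
      ⊆lps∷pals : palindromicFactors (x ++ [ a ]) ⊆ LongestPalindromicSuffix.word lps ∷ palindromicFactors x
      ⊆lps∷pals f∈ with ∈-palindromicFactors⁻ f∈
      ... | f-infix , f-pal with newPalindrome≡longestPalindromicSuffix lps f-infix f-pal
      ...   | inj₁ f-infix-x = there (∈-palindromicFactors⁺ f-infix-x f-pal)
      ...   | inj₂ f≡lps     = here f≡lps

module _ (N : ℕ → ℕ) (N-step : ∀ n → N (suc n) ≤ suc (N n)) where

  lag-mono : {k m n : ℕ} → m ≤′ n → k + N m ≤ suc m → k + N n ≤ suc n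
  lag-mono     ≤′-refl            lag = lag
  lag-mono {k} (≤′-step {n} m≤′n) lag =
    ≤-trans (+-monoʳ-≤ k (N-step n)) (≤-trans (≤-reflexive (+-suc k (N n))) (s≤s (lag-mono m≤′n lag)))

  lag-unbounded : N 0 ≤ 1 → (∀ m → ∃ λ e → m ≤ e × N (suc e) ≤ N e) → ∀ k → ∃ λ n → k + N n ≤ suc n
  lag-unbounded N0≤1 stalls zero    = 0 , N0≤1
  lag-unbounded N0≤1 stalls (suc k) with lag-unbounded N0≤1 stalls k
  ... | n , lag with stalls n
  ...   | e , n≤e , stall = suc e , s≤s (≤-trans (+-monoʳ-≤ k stall) (lag-mono (≤⇒≤′ n≤e) lag))

module _ {A : Set} (w : Word∞ A) where

  length-window : (i n : ℕ) → length (window w i n) ≡ n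
  length-window i zero    = refl
  length-window i (suc n) = cong suc (length-window (suc i) n)

  window-+ : (i m n : ℕ) → window w i (m + n) ≡ window w i m ++ window w (i + m) n
  window-+ i zero    n = cong (λ j → window w j n) (sym (+-identityʳ i))
  window-+ i (suc m) n = cong (w i ∷_) (trans (window-+ (suc i) m n)
                                              (cong (λ j → window w (suc i) m ++ window w j n) (sym (+-suc i m))))

  prefix-suc : (n : ℕ) → prefix w (suc n) ≡ prefix w n ++ [ w n ]
  prefix-suc n = trans (cong (prefix w) (+-comm 1 n)) (window-+ 0 n 1)

  infix-window⇒factor : {f : List A} (i n : ℕ) → IsInfix f (window w i n) → Factor∞ f w
  infix-window⇒factor {f} i n (p , s , pfs≡win) =
    i + length p ,
    proj₁ (++-cancel-≡-length (window w (i + length p) (length f)) fs≡fs (length-window _ (length f)))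
    where
      open ≡-Reasoning
      n≡ : length p + (length f + length s) ≡ n
      n≡ = trans (cong (length p +_) (sym (length-++ f))) (trans (length-++-≡ p pfs≡win) (length-window i n))
      pfs≡pfs : window w i (length p) ++ window w (i + length p) (length f + length s) ≡ p ++ f ++ s
      pfs≡pfs = begin
        window w i (length p) ++ window w (i + length p) (length f + length s) ≡⟨ window-+ i (length p) _ ⟨
        window w i (length p + (length f + length s))                          ≡⟨ cong (window w i) n≡ ⟩
        window w i n                                                           ≡⟨ pfs≡win ⟨
        p ++ f ++ s                                                            ∎
      fs≡fs : window w (i + length p) (length f) ++ window w (i + length p + length f) (length s) ≡ f ++ s
      fs≡fs = trans (sym (window-+ (i + length p) (length f) (length s)))
                    (proj₂ (++-cancel-≡-length (window w i (length p)) {c = p} pfs≡pfs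
                                               (length-window i (length p))))

  prefix-of-factor : {v u : List A} → IsPrefix v u → Factor∞ u w → Factor∞ v w
  prefix-of-factor {u = u} (t , vt≡u) (i , win≡u) =
    infix-window⇒factor i (length u) ([] , t , trans vt≡u (sym win≡u))

module _ {A : Set} (_≟_ : DecidableEquality A) (w : Word∞ A) where

  prefixPalCount : ℕ → ℕ
  prefixPalCount n = numPalFactors _≟_ (prefix w n)

  prefixPalCount-suc : (n : ℕ) → prefixPalCount (suc n) ≤ suc (prefixPalCount n)
  prefixPalCount-suc n =
    subst (λ y → numPalFactors _≟_ y ≤ suc (prefixPalCount n)) (sym (prefix-suc w n))
          (numPalFactors-snoc _≟_ (prefix w n) (w n))

  recurrentReturn⇒stalls : Recurrent w → (∀ u → Factor∞ u w → IsPalindrome u → Privileged u) →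
    {q r : List A} → Factor∞ r w → ReturnToPalindrome q r →
    ∀ m → ∃ λ e → m ≤ e × prefixPalCount (suc e) ≤ prefixPalCount e
  recurrentReturn⇒stalls rec palPriv {r = []}    _        ret _ = ⊥-elim (n≮0 (ReturnToPalindrome.shorter ret))
  recurrentReturn⇒stalls rec palPriv {r = c ∷ r} r-factor ret m with rec (c ∷ r) r-factor m
  ... | j , m≤j , win≡cr = e , ≤-trans m≤j (m≤m+n j (length r)) , stall
    where
      e : ℕ
      e = j + length r
      ends-with-cr : IsSuffix (c ∷ r) (prefix w e ++ [ w e ])
      ends-with-cr = prefix w j , sym (begin
        prefix w e ++ [ w e ]                      ≡⟨ prefix-suc w e ⟨
        prefix w (suc e)                           ≡⟨ cong (prefix w) (+-suc j (length r)) ⟨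
        prefix w (j + suc (length r))              ≡⟨ window-+ w 0 j (suc (length r)) ⟩
        prefix w j ++ window w j (suc (length r))  ≡⟨ cong (prefix w j ++_) win≡cr ⟩
        prefix w j ++ c ∷ r                        ∎)
        where open ≡-Reasoning
      palPriv′ : ∀ f → IsInfix f (prefix w e ++ [ w e ]) → IsPalindrome f → Privileged f
      palPriv′ f f-infix =
        palPriv f (infix-window⇒factor w 0 (suc e) (subst (IsInfix f) (sym (prefix-suc w e)) f-infix))
      stall : prefixPalCount (suc e) ≤ prefixPalCount e
      stall = subst (λ y → numPalFactors _≟_ y ≤ prefixPalCount e) (sym (prefix-suc w e))
                    (numPalFactors-mono _≟_ (Return.noNewPalindrome ret palPriv′ ends-with-cr))

lemma3p4 : {A : Set} (_≟_ : DecidableEquality A) (w : Word∞ A) →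
    Recurrent w →
    (∀ (u : List A) → Factor∞ u w → IsPalindrome u → Privileged u) →
    (∃ λ (u : List A) → Factor∞ u w × Privileged u × ¬ IsPalindrome u) →
    InfiniteDefect _≟_ w
lemma3p4 _≟_ w rec palPriv (u , u-factor , u-priv , ¬u-pal) k
  with privilegedNonPalindrome⇒return _≟_ u-priv ¬u-pal
... | q , r , r-prefix , ret
  with lag-unbounded (prefixPalCount _≟_ w) (prefixPalCount-suc _≟_ w) (s≤s z≤n)
         (recurrentReturn⇒stalls _≟_ w rec palPriv (prefix-of-factor w r-prefix u-factor) ret) k
... | n , lag =
  n , subst (λ l → k ≤ suc l ∸ prefixPalCount _≟_ w n) (sym (length-window w 0 n)) (m+n≤o⇒m≤o∸n k lag)
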